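{- Let $P$ be a finite poset with $|P|\ge2$ whose Hasse diagram is connected, and suppose $U_P$ is $\mathbb{Q}$-Gorenstein. Then $P$ has a chamber crepant labeling if and only if the birational map $X_P\dashrightarrow U_P$ is crepant.
   Context: Identify $P$ with $[n]$. Let $N=\mathbb{Z}^n/\mathbb{Z}(1,\dots,1)$, $N_{\mathbb{R}}=N\otimes\mathbb{R}$, $M$ the dual lattice, $e_A=\sum_{i\in A}e_i$. The braid cone $\sigma_P=\{x\in N_{\mathbb{R}}: x_i\le x_j \text{ whenever } i<_P j\}$; $U_P$ is its affine toric variety. $\Sigma_P$ is the fan consisting of the cones $\sigma_L$, for all linear extensions $L$ of $P$, together with their faces; it is a smooth fan refining $\sigma_P$, and $X_P$ is its toric variety. $U_P$ is $\mathbb{Q}$-Gorenstein of index $r$ if $r$ is the least positive integer such that some $u\in M$ has $\langle u,v\rangle=r$ for all ray generators $v$ of $\sigma_P$. The resolution $X_P\dashrightarrow U_P$ is crepant if, for such $u$ and $r$, also $\langle u,v\rangle=r$ for every ray generator $v$ of $\Sigma_P$. For $S\subseteq P$, $cc(S)$ is the number of connected components of the subgraph of the undirected Hasse diagram induced on $S$ ($cc(\varnothing)=0$); for an upset $A$, $\dim(A)=cc(A)+cc(P\setminus A)-1$. If $U_P$ is $\mathbb{Q}$-Gorenstein with index $r$, a chamber crepant labeling of $P$ is a function $\phi:P\to\mathbb{Z}$ with $\sum_{i\in P}\phi(i)=0$ and $\sum_{i\in A}\phi(i)=r$ for all upsets $A$ with $\dim(A)>0$. -}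

module Defs where

open import Level using (0ℓ)
open import Data.Nat as ℕ using (ℕ; zero; suc)
open import Data.Integer as ℤ using (ℤ; +_; 0ℤ)
open import Data.Fin as Fin using (Fin)
open import Data.Fin.Subset using (Subset; _∈_; ∁; ⊤)
open import Data.Fin.Permutation using (Permutation′; _⟨$⟩ʳ_)
open import Data.Product using (Σ; ∃; _×_; _,_)
open import Data.Sum using (_⊎_)
open import Data.Bool using (true; if_then_else_)
open import Data.Vec using (lookup)
open import Relation.Binary using (Rel; IsStrictPartialOrder; Decidable)
open import Relation.Binary.PropositionalEquality using (_≡_)
open import Relation.Nullary using (¬_)
open import Function.Bundles using (_⇔_)

record FinPoset (n : ℕ) : Set₁ where
  field
    _<P_    : Rel (Fin n) 0ℓ
    isSPO   : IsStrictPartialOrder _≡_ _<P_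
    _<P?_   : Decidable _<P_
open FinPoset public

Covers : ∀ {n} → FinPoset n → Fin n → Fin n → Set
Covers P i j = (_<P_ P i j) × ¬ (∃ λ k → _<P_ P i k × _<P_ P k j)

HasseAdj : ∀ {n} → FinPoset n → Fin n → Fin n → Set
HasseAdj P i j = Covers P i j ⊎ Covers P j i

data Reach {n} (P : FinPoset n) (S : Subset n) : Fin n → Fin n → Set where
  here : ∀ {i} → i ∈ S → Reach P S i i
  step : ∀ {i j k} → i ∈ S → HasseAdj P i j → Reach P S j k → Reach P S i k

HasseConnected : ∀ {n} → FinPoset n → Set
HasseConnected {n} P = ∀ (i j : Fin n) → Reach P ⊤ i j

-- HasCC P S k : the induced subgraph on S has exactly k connected
-- components, i.e. there is a labeling of the vertices of S by Fin k,
-- onto, whose fibres are exactly the connected components.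
HasCC : ∀ {n} → FinPoset n → Subset n → ℕ → Set
HasCC {n} P S k =
  Σ ((i : Fin n) → i ∈ S → Fin k) λ c →
    (∀ i j (i∈S : i ∈ S) (j∈S : j ∈ S) → Reach P S i j ⇔ (c i i∈S ≡ c j j∈S))
    × (∀ (m : Fin k) → ∃ λ i → Σ (i ∈ S) λ i∈S → c i i∈S ≡ m)

IsUpset : ∀ {n} → FinPoset n → Subset n → Set
IsUpset P A = ∀ i j → i ∈ A → _<P_ P i j → j ∈ A

-- dim(A) > 0, i.e. cc(A) + cc(P ∖ A) - 1 > 0
DimPositive : ∀ {n} → FinPoset n → Subset n → Set
DimPositive P A = ∀ a b → HasCC P A a → HasCC P (∁ A) b → 2 ℕ.≤ a ℕ.+ b

sumFin : ∀ n → (Fin n → ℤ) → ℤ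
sumFin zero    f = 0ℤ
sumFin (suc n) f = f Fin.zero ℤ.+ sumFin n (λ i → f (Fin.suc i))

sumOver : ∀ {n} → Subset n → (Fin n → ℤ) → ℤ
sumOver {n} A f = sumFin n (λ i → if lookup A i then f i else 0ℤ)

-- The lattices N = ℤ^n / ℤ(1,…,1) and M = its dual.
-- Elements of N are represented by integer vectors Fin n → ℤ, with
-- equality in N given by _≈N_ (differ by a constant vector).
-- M = { u ∈ ℤ^n : Σ u_i = 0 }, with the pairing ⟨u,x⟩ = Σ u_i x_i,
-- which is well defined on N.

Vecℤ : ℕ → Set
Vecℤ n = Fin n → ℤ

_≈N_ : ∀ {n} → Vecℤ n → Vecℤ n → Set
x ≈N y = ∃ λ (c : ℤ) → ∀ i → x i ≡ y i ℤ.+ c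

InM : ∀ {n} → Vecℤ n → Set
InM {n} u = sumFin n u ≡ 0ℤ

⟨_,_⟩ : ∀ {n} → Vecℤ n → Vecℤ n → ℤ
⟨_,_⟩ {n} u x = sumFin n (λ i → u i ℤ.* x i)

_·N_ : ∀ {n} → ℕ → Vecℤ n → Vecℤ n
(k ·N v) i = + k ℤ.* v i

-- Braid cones and their ray generators.
-- For a relation R on [n], BraidCone R = { x : x_i ≤ x_j whenever R i j }
-- (a rational polyhedral cone in N_ℝ; lattice points are given here).

BraidCone : ∀ {n} → Rel (Fin n) 0ℓ → Vecℤ n → Set
BraidCone R x = ∀ i j → R i j → x i ℤ.≤ x j

-- v is a ray generator of the cone C: v is the primitive lattice
-- generator of a 1-dimensional face of C.  Faces are cut out by a
-- supporting functional u ∈ M (u ≥ 0 on C); the face {x ∈ C : ⟨u,x⟩ = 0}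
-- is the ray ℝ≥0 v with v primitive iff its lattice points are exactly
-- the ℕ-multiples of v (and v ≠ 0 in N).
IsRayGen : ∀ {n} → Rel (Fin n) 0ℓ → Vecℤ n → Set
IsRayGen {n} R v =
  BraidCone R v × ¬ (v ≈N (λ _ → 0ℤ)) ×
  (∃ λ (u : Vecℤ n) → InM u
     × (∀ x → BraidCone R x → 0ℤ ℤ.≤ ⟨ u , x ⟩)
     × ⟨ u , v ⟩ ≡ 0ℤ
     × (∀ x → BraidCone R x → ⟨ u , x ⟩ ≡ 0ℤ → ∃ λ (k : ℕ) → x ≈N (k ·N v)))

σ : ∀ {n} → FinPoset n → Rel (Fin n) 0ℓ
σ P = _<P_ P

-- Linear extensions L of P, given as a bijection π : [n] → [n]
-- (π i = position of i in L) with i <_P j ⇒ π i < π j.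
LinearExtension : ∀ {n} → FinPoset n → Set
LinearExtension {n} P =
  Σ (Permutation′ n) λ π → ∀ i j → _<P_ P i j → (π ⟨$⟩ʳ i) Fin.< (π ⟨$⟩ʳ j)

-- the order relation of L; σ_L = BraidCone (σL L)
σL : ∀ {n} {P : FinPoset n} → LinearExtension P → Rel (Fin n) 0ℓ
σL (π , _) i j = (π ⟨$⟩ʳ i) Fin.< (π ⟨$⟩ʳ j)

-- ray generators of the fan Σ_P (cones σ_L and their faces): the rays of
-- Σ_P are exactly the rays of the maximal cones σ_L.
IsFanRayGen : ∀ {n} → FinPoset n → Vecℤ n → Set
IsFanRayGen P v = ∃ λ (L : LinearExtension P) → IsRayGen (σL {P = P} L) v

GorWitness : ∀ {n} → FinPoset n → ℕ → Vecℤ n → Set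
GorWitness P r u = InM u × (∀ v → IsRayGen (σ P) v → ⟨ u , v ⟩ ≡ + r)

IsGorensteinIndex : ∀ {n} → FinPoset n → ℕ → Set
IsGorensteinIndex {n} P r =
  1 ℕ.≤ r × (∃ λ (u : Vecℤ n) → GorWitness P r u)
  × (∀ r′ → 1 ℕ.≤ r′ → (∃ λ (u : Vecℤ n) → GorWitness P r′ u) → r ℕ.≤ r′)

IsCrepant : ∀ {n} → FinPoset n → ℕ → Set
IsCrepant {n} P r =
  ∃ λ (u : Vecℤ n) → GorWitness P r u × (∀ v → IsFanRayGen P v → ⟨ u , v ⟩ ≡ + r)

ChamberCrepantLabeling : ∀ {n} → FinPoset n → ℕ → Set
ChamberCrepantLabeling {n} P r =
  Σ (Fin n → ℤ) λ φ → sumFin n φ ≡ 0ℤ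
    × (∀ A → IsUpset P A → DimPositive P A → sumOver A φ ≡ + r)

{-# OPTIONS --safe #-}
-- Both conditions say that some u ∈ M takes the value r on a family of ray generators, and in
-- both cases these are, up to N, the indicator vectors 𝟙 A (the paper's e_A) of the nonempty
-- proper upsets A.  A ray generator v of a braid cone is such a vector: cutting v at a value t it
-- jumps over writes v − t = 𝟙 A + w with 𝟙 A and w in the cone, so the functional cutting out the
-- ray vanishes on 𝟙 A.  Conversely a nonempty proper upset A is an upset of some linear extension,
-- and 𝟙 A spans a ray of that chamber.  Connectedness makes dim(A) > 0 mean exactly that A is
-- nonempty and proper.
module Submission where

open import Defs
open import Data.Nat using (ℕ; _≤_)
open import Function.Bundles using (_⇔_)

open import Level using (0ℓ)
open import Function.Base using (_∘_)
open import Function.Bundles using (mk⇔; Equivalence)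
open import Function.Definitions using (Injective)
open import Data.Bool using (true; false; if_then_else_)
open import Data.Empty using (⊥-elim)
open import Data.Product using (Σ; ∃; ∃₂; _×_; _,_; proj₁; proj₂)
open import Data.Sum using (_⊎_; inj₁; inj₂)
open import Data.Nat as ℕ using (zero; suc; _<_; z≤n; s≤s)
import Data.Nat.Properties as ℕₚ
open import Data.Integer as ℤ using (ℤ; +_; 0ℤ; -_; _+_; _-_; _*_)
import Data.Integer.Properties as ℤₚ
open import Data.Integer.Tactic.RingSolver using (solve-∀)
open import Algebra.Properties.Semiring.Sum ℤₚ.+-*-semiring
  using (sum; sum-cong-≗; sum-replicate-zero; ∑-distrib-+; ∑-comm; *-distribˡ-sum; *-distribʳ-sum)
open import Data.Fin as Fin using (Fin; toℕ)
import Data.Fin.Properties as Finₚ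
open import Data.Fin.Subset using (Subset; _∈_; _∉_; ∁; ∣_∣)
import Data.Fin.Subset.Properties as Subsetₚ
open import Data.Fin.Permutation using (Permutation′; _⟨$⟩ʳ_; _⟨$⟩ˡ_; inverseˡ; inverseʳ; permutation)
open import Data.Vec using (lookup; tabulate)
import Data.Vec.Properties as Vecₚ
open import Relation.Nullary using (¬_; yes; no; does)
open import Relation.Nullary.Decidable using (dec-true)
open import Relation.Unary using (Pred) renaming (Decidable to Decidable₁)
open import Relation.Binary using (Rel; Decidable; Transitive; Irreflexive; IsStrictPartialOrder; tri<; tri≈; tri>)
open import Relation.Binary.PropositionalEquality

sumFin≡sum : ∀ n (f : Fin n → ℤ) → sumFin n f ≡ sum f
sumFin≡sum zero    f = refl
sumFin≡sum (suc n) f = cong (_+_ (f Fin.zero)) (sumFin≡sum n (f ∘ Fin.suc))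

sumFin-cong : ∀ n {f g : Fin n → ℤ} → (∀ i → f i ≡ g i) → sumFin n f ≡ sumFin n g
sumFin-cong n {f} {g} f≗g = begin
  sumFin n f ≡⟨ sumFin≡sum n f ⟩
  sum f      ≡⟨ sum-cong-≗ f≗g ⟩
  sum g      ≡⟨ sumFin≡sum n g ⟨
  sumFin n g ∎
  where open ≡-Reasoning

sumFin-zero : ∀ n → sumFin n (λ _ → 0ℤ) ≡ 0ℤ
sumFin-zero n = trans (sumFin≡sum n _) (sum-replicate-zero n)

+-nonneg-≡0ˡ : ∀ {p q : ℤ} → 0ℤ ℤ.≤ p → 0ℤ ℤ.≤ q → p + q ≡ 0ℤ → p ≡ 0ℤ
+-nonneg-≡0ˡ {p} p≥0 q≥0 p+q≡0 =
  ℤₚ.≤-antisym (subst₂ ℤ._≤_ (ℤₚ.+-identityʳ p) p+q≡0 (ℤₚ.+-monoʳ-≤ p q≥0)) p≥0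

sumFin-nonneg : ∀ n {f : Fin n → ℤ} → (∀ i → 0ℤ ℤ.≤ f i) → 0ℤ ℤ.≤ sumFin n f
sumFin-nonneg zero    f≥0 = ℤₚ.≤-refl
sumFin-nonneg (suc n) f≥0 = ℤₚ.+-mono-≤ (f≥0 Fin.zero) (sumFin-nonneg n (f≥0 ∘ Fin.suc))

sumFin-nonneg-≡0 : ∀ n {f : Fin n → ℤ} → (∀ i → 0ℤ ℤ.≤ f i) → sumFin n f ≡ 0ℤ → ∀ i → f i ≡ 0ℤ
sumFin-nonneg-≡0 (suc n) {f} f≥0 Σf≡0 Fin.zero =
  +-nonneg-≡0ˡ (f≥0 Fin.zero) (sumFin-nonneg n (f≥0 ∘ Fin.suc)) Σf≡0
sumFin-nonneg-≡0 (suc n) {f} f≥0 Σf≡0 (Fin.suc i) =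
  sumFin-nonneg-≡0 n (f≥0 ∘ Fin.suc)
    (+-nonneg-≡0ˡ (sumFin-nonneg n (f≥0 ∘ Fin.suc)) (f≥0 Fin.zero)
      (trans (ℤₚ.+-comm _ (f Fin.zero)) Σf≡0)) i

⟨,⟩≡sum : ∀ {n} (u x : Vecℤ n) → ⟨ u , x ⟩ ≡ sum (λ i → u i * x i)
⟨,⟩≡sum {n} u x = sumFin≡sum n _

pairing-+ʳ : ∀ {n} (u x y : Vecℤ n) → ⟨ u , (λ i → x i + y i) ⟩ ≡ ⟨ u , x ⟩ + ⟨ u , y ⟩
pairing-+ʳ u x y = begin
  ⟨ u , (λ i → x i + y i) ⟩           ≡⟨ ⟨,⟩≡sum u _ ⟩
  sum (λ i → u i * (x i + y i))       ≡⟨ sum-cong-≗ (λ i → ℤₚ.*-distribˡ-+ (u i) (x i) (y i)) ⟩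
  sum (λ i → u i * x i + u i * y i)   ≡⟨ ∑-distrib-+ (λ i → u i * x i) (λ i → u i * y i) ⟩
  sum (λ i → u i * x i) + sum (λ i → u i * y i) ≡⟨ cong₂ _+_ (⟨,⟩≡sum u x) (⟨,⟩≡sum u y) ⟨
  ⟨ u , x ⟩ + ⟨ u , y ⟩                ∎
  where open ≡-Reasoning

pairing-−ˡ : ∀ {n} (u v x : Vecℤ n) → ⟨ (λ i → u i - v i) , x ⟩ ≡ ⟨ u , x ⟩ - ⟨ v , x ⟩
pairing-−ˡ u v x = begin
  ⟨ (λ i → u i - v i) , x ⟩                               ≡⟨ ⟨,⟩≡sum (λ i → u i - v i) x ⟩
  sum (λ i → (u i - v i) * x i)                           ≡⟨ sum-cong-≗ (λ i → expand (u i) (v i) (x i)) ⟩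
  sum (λ i → u i * x i + ℤ.-1ℤ * (v i * x i))             ≡⟨ ∑-distrib-+ (λ i → u i * x i) (λ i → ℤ.-1ℤ * (v i * x i)) ⟩
  sum (λ i → u i * x i) + sum (λ i → ℤ.-1ℤ * (v i * x i)) ≡⟨ cong (_+_ (sum (λ i → u i * x i))) (*-distribˡ-sum ℤ.-1ℤ (λ i → v i * x i)) ⟨
  sum (λ i → u i * x i) + ℤ.-1ℤ * sum (λ i → v i * x i)   ≡⟨ cong₂ (λ s t → s + ℤ.-1ℤ * t) (⟨,⟩≡sum u x) (⟨,⟩≡sum v x) ⟨
  ⟨ u , x ⟩ + ℤ.-1ℤ * ⟨ v , x ⟩                            ≡⟨ cong (_+_ ⟨ u , x ⟩) (ℤₚ.-1*i≡-i ⟨ v , x ⟩) ⟩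
  ⟨ u , x ⟩ - ⟨ v , x ⟩                                    ∎
  where
  open ≡-Reasoning
  expand : ∀ (a b c : ℤ) → (a - b) * c ≡ a * c + ℤ.-1ℤ * (b * c)
  expand = solve-∀

pairing-constʳ : ∀ {n} (u : Vecℤ n) (c : ℤ) → InM u → ⟨ u , (λ _ → c) ⟩ ≡ 0ℤ
pairing-constʳ {n} u c u∈M = begin
  ⟨ u , (λ _ → c) ⟩ ≡⟨ ⟨,⟩≡sum u _ ⟩
  sum (λ i → u i * c) ≡⟨ *-distribʳ-sum c u ⟨
  sum u * c         ≡⟨ cong (λ s → s * c) (trans (sym (sumFin≡sum n u)) u∈M) ⟩
  0ℤ * c            ≡⟨ ℤₚ.*-zeroˡ c ⟩
  0ℤ                ∎
  where open ≡-Reasoning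

pairing-≈N : ∀ {n} (u : Vecℤ n) {x y : Vecℤ n} → InM u → x ≈N y → ⟨ u , x ⟩ ≡ ⟨ u , y ⟩
pairing-≈N {n} u {x} {y} u∈M (c , x≡y+c) = begin
  ⟨ u , x ⟩                         ≡⟨ sumFin-cong n (λ i → cong (u i *_) (x≡y+c i)) ⟩
  ⟨ u , (λ i → y i + c) ⟩           ≡⟨ pairing-+ʳ u y (λ _ → c) ⟩
  ⟨ u , y ⟩ + ⟨ u , (λ _ → c) ⟩     ≡⟨ cong (_+_ ⟨ u , y ⟩) (pairing-constʳ u c u∈M) ⟩
  ⟨ u , y ⟩ + 0ℤ                    ≡⟨ ℤₚ.+-identityʳ ⟨ u , y ⟩ ⟩
  ⟨ u , y ⟩                         ∎
  where open ≡-Reasoning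

InM-from-pairing : ∀ {n} (u : Vecℤ n) → ⟨ u , (λ _ → + 1) ⟩ ≡ 0ℤ → InM u
InM-from-pairing {n} u ⟨u,1⟩≡0 = trans (sumFin-cong n (λ i → sym (ℤₚ.*-identityʳ (u i)))) ⟨u,1⟩≡0

e : ∀ {n} → Fin n → Vecℤ n
e Fin.zero    Fin.zero    = + 1
e Fin.zero    (Fin.suc _) = 0ℤ
e (Fin.suc _) Fin.zero    = 0ℤ
e (Fin.suc k) (Fin.suc i) = e k i

⟨e,x⟩≡x : ∀ {n} (k : Fin n) (x : Vecℤ n) → ⟨ e k , x ⟩ ≡ x k
⟨e,x⟩≡x {suc n} Fin.zero x = begin
  + 1 * x Fin.zero + sumFin n (λ i → 0ℤ * x (Fin.suc i)) ≡⟨ cong₂ _+_ (ℤₚ.*-identityˡ (x Fin.zero)) rest≡0 ⟩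
  x Fin.zero + 0ℤ                                          ≡⟨ ℤₚ.+-identityʳ (x Fin.zero) ⟩
  x Fin.zero                                               ∎
  where
  open ≡-Reasoning
  rest≡0 : sumFin n (λ i → 0ℤ * x (Fin.suc i)) ≡ 0ℤ
  rest≡0 = trans (sumFin-cong n (λ i → ℤₚ.*-zeroˡ (x (Fin.suc i)))) (sumFin-zero n)
⟨e,x⟩≡x {suc n} (Fin.suc k) x = trans (ℤₚ.+-identityˡ _) (⟨e,x⟩≡x k (x ∘ Fin.suc))

differences : ∀ {m n} → (Fin m → Fin n) → (Fin m → Fin n) → Vecℤ n
differences {m} hi lo i = sumFin m (λ k → e (hi k) i - e (lo k) i)

⟨differences,x⟩ : ∀ {m n} (hi lo : Fin m → Fin n) (x : Vecℤ n) →
  ⟨ differences hi lo , x ⟩ ≡ sumFin m (λ k → x (hi k) - x (lo k))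
⟨differences,x⟩ {m} hi lo x = begin
  ⟨ differences hi lo , x ⟩                     ≡⟨ ⟨,⟩≡sum (differences hi lo) x ⟩
  sum (λ i → sumFin m (λ k → d k i) * x i)      ≡⟨ sum-cong-≗ (λ i → cong (λ s → s * x i) (sumFin≡sum m _)) ⟩
  sum (λ i → sum (λ k → d k i) * x i)           ≡⟨ sum-cong-≗ (λ i → *-distribʳ-sum (x i) (λ k → d k i)) ⟩
  sum (λ i → sum (λ k → d k i * x i))           ≡⟨ ∑-comm (λ i k → d k i * x i) ⟩
  sum (λ k → sum (λ i → d k i * x i))           ≡⟨ sum-cong-≗ (λ k → sym (⟨,⟩≡sum (d k) x)) ⟩
  sum (λ k → ⟨ d k , x ⟩)                       ≡⟨ sum-cong-≗ (λ k → ⟨d,x⟩ k) ⟩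
  sum (λ k → x (hi k) - x (lo k))               ≡⟨ sumFin≡sum m _ ⟨
  sumFin m (λ k → x (hi k) - x (lo k))          ∎
  where
  open ≡-Reasoning
  d : _ → Vecℤ _
  d k i = e (hi k) i - e (lo k) i
  ⟨d,x⟩ : ∀ k → ⟨ d k , x ⟩ ≡ x (hi k) - x (lo k)
  ⟨d,x⟩ k = trans (pairing-−ˡ (e (hi k)) (e (lo k)) x) (cong₂ _-_ (⟨e,x⟩≡x (hi k) x) (⟨e,x⟩≡x (lo k) x))

if-∈ : ∀ {a} {X : Set a} {n} {A : Subset n} {i} {x y : X} → i ∈ A → (if lookup A i then x else y) ≡ x
if-∈ i∈A rewrite Vecₚ.[]=⇒lookup i∈A = refl

if-∉ : ∀ {a} {X : Set a} {n} {A : Subset n} {i} {x y : X} → i ∉ A → (if lookup A i then x else y) ≡ y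
if-∉ {A = A} {i} i∉A with lookup A i in eq
... | true  = ⊥-elim (i∉A (Vecₚ.lookup⇒[]= i A eq))
... | false = refl

toSubset : ∀ {n} {P : Pred (Fin n) 0ℓ} → Decidable₁ P → Subset n
toSubset P? = tabulate (does ∘ P?)

∈-toSubset : ∀ {n} {P : Pred (Fin n) 0ℓ} (P? : Decidable₁ P) {i} → i ∈ toSubset P? ⇔ P i
∈-toSubset P? {i} = mk⇔ to from
  where
  lookup-toSubset : lookup (toSubset P?) i ≡ does (P? i)
  lookup-toSubset = Vecₚ.lookup∘tabulate (does ∘ P?) i
  to : i ∈ toSubset P? → _
  to i∈ with P? i in eq
  ... | yes p = p
  ... | no _  with () ← trans (sym (Vecₚ.[]=⇒lookup i∈)) (trans lookup-toSubset (cong does eq))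
  from : _ → i ∈ toSubset P?
  from p = Vecₚ.lookup⇒[]= i _ (trans lookup-toSubset (dec-true (P? i) p))

𝟙 : ∀ {n} → Subset n → Vecℤ n
𝟙 A i = if lookup A i then + 1 else 0ℤ

pairing-𝟙 : ∀ {n} (u : Vecℤ n) (A : Subset n) → ⟨ u , 𝟙 A ⟩ ≡ sumOver A u
pairing-𝟙 {n} u A = sumFin-cong n u*𝟙A
  where
  u*𝟙A : ∀ i → u i * 𝟙 A i ≡ (if lookup A i then u i else 0ℤ)
  u*𝟙A i with lookup A i
  ... | true  = ℤₚ.*-identityʳ (u i)
  ... | false = ℤₚ.*-zeroʳ (u i)

UpClosed : ∀ {n} → Rel (Fin n) 0ℓ → Subset n → Set
UpClosed R A = ∀ i j → i ∈ A → R i j → j ∈ A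

ProperUpClosed : ∀ {n} → Rel (Fin n) 0ℓ → Subset n → Set
ProperUpClosed R A = UpClosed R A × (∃ λ a → a ∈ A) × (∃ λ b → b ∉ A)

𝟙∈BraidCone : ∀ {n} {R : Rel (Fin n) 0ℓ} {A} → UpClosed R A → BraidCone R (𝟙 A)
𝟙∈BraidCone {A = A} A-up i j Rij with i Subsetₚ.∈? A | j Subsetₚ.∈? A
... | yes i∈A | yes j∈A = ℤₚ.≤-reflexive (trans (if-∈ i∈A) (sym (if-∈ j∈A)))
... | yes i∈A | no j∉A  = ⊥-elim (j∉A (A-up i j i∈A Rij))
... | no i∉A  | yes j∈A = subst₂ ℤ._≤_ (sym (if-∉ i∉A)) (sym (if-∈ j∈A)) (ℤ.+≤+ z≤n)
... | no i∉A  | no j∉A  = ℤₚ.≤-reflexive (trans (if-∉ i∉A) (sym (if-∉ j∉A)))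

nonconstant : ∀ {n} (v : Vecℤ n) → ¬ v ≈N (λ _ → 0ℤ) → ∃₂ λ b a → v b ℤ.< v a
nonconstant {zero}  v v≉0 = ⊥-elim (v≉0 (0ℤ , λ ()))
nonconstant {suc n} v v≉0 with Finₚ.any? (λ b → Finₚ.any? (λ a → v b ℤₚ.<? v a))
... | yes (b , a , vb<va) = b , a , vb<va
... | no no-jump = ⊥-elim (v≉0 (v Fin.zero , λ i → trans (v≡v₀ i) (sym (ℤₚ.+-identityˡ (v Fin.zero)))))
  where
  v≡v₀ : ∀ i → v i ≡ v Fin.zero
  v≡v₀ i = ℤₚ.≤-antisym (ℤₚ.≮⇒≥ (λ lt → no-jump (Fin.zero , i , lt)))
                        (ℤₚ.≮⇒≥ (λ lt → no-jump (i , Fin.zero , lt)))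

above : ℤ → ℤ → ℤ
above t x = if does (t ℤₚ.<? x) then + 1 else 0ℤ

excess : ℤ → ℤ → ℤ
excess t x = (x - t) - above t x

excess-mono : ∀ t {x y} → x ℤ.≤ y → excess t x ℤ.≤ excess t y
excess-mono t {x} {y} x≤y with t ℤₚ.<? x | t ℤₚ.<? y
... | yes _   | yes _   = ℤₚ.+-monoˡ-≤ (- + 1) (ℤₚ.+-monoˡ-≤ (- t) x≤y)
... | no _    | no _    = ℤₚ.+-monoˡ-≤ (- 0ℤ) (ℤₚ.+-monoˡ-≤ (- t) x≤y)
... | yes t<x | no t≮y  = ⊥-elim (t≮y (ℤₚ.<-≤-trans t<x x≤y))
... | no t≮x  | yes t<y = ℤₚ.≤-trans x-t≤0 0≤y-t-1
  where
  x-t≤0 : (x - t) - 0ℤ ℤ.≤ 0ℤ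
  x-t≤0 = subst (ℤ._≤ 0ℤ) (sym (ℤₚ.+-identityʳ (x - t))) (ℤₚ.i≤j⇒i-j≤0 (ℤₚ.≮⇒≥ t≮x))
  0≤y-t-1 : 0ℤ ℤ.≤ (y - t) - + 1
  0≤y-t-1 = subst (0ℤ ℤ.≤_) (regroup y t) (ℤₚ.i≤j⇒0≤j-i (ℤₚ.i<j⇒suc[i]≤j t<y))
    where
    regroup : ∀ (y t : ℤ) → y - (+ 1 + t) ≡ (y - t) - + 1
    regroup = solve-∀

+k*x≡1⇒k≡1 : ∀ k x → + k * x ≡ + 1 → k ≡ 1
+k*x≡1⇒k≡1 k x kx≡1 = ℕₚ.m*n≡1⇒m≡1 k ℤ.∣ x ∣ (trans (sym (ℤₚ.abs-* (+ k) x)) (cong ℤ.∣_∣ kx≡1))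

rayGen⇒upsetIndicator : ∀ {n} (R : Rel (Fin n) 0ℓ) {v : Vecℤ n} → IsRayGen R v →
  ∃ λ A → ProperUpClosed R A × v ≈N 𝟙 A
rayGen⇒upsetIndicator R {v} (v∈C , v≉0 , u , u∈M , u≥0 , ⟨u,v⟩≡0 , face)
  with b , a , vb<va ← nonconstant v v≉0 =
  A , (A-up , (a , a∈A) , (b , b∉A)) , fromFace (face (𝟙 A) (𝟙∈BraidCone A-up) ⟨u,𝟙A⟩≡0)
  where
  open ≡-Reasoning
  t = v b
  A = toSubset (λ i → t ℤₚ.<? v i)
  ∈A⇒ : ∀ {i} → i ∈ A → t ℤ.< v i
  ∈A⇒ = Equivalence.to (∈-toSubset (λ i → t ℤₚ.<? v i))
  ⇒∈A : ∀ {i} → t ℤ.< v i → i ∈ A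
  ⇒∈A = Equivalence.from (∈-toSubset (λ i → t ℤₚ.<? v i))

  A-up : UpClosed R A
  A-up i j i∈A Rij = ⇒∈A (ℤₚ.<-≤-trans (∈A⇒ i∈A) (v∈C i j Rij))
  a∈A : a ∈ A
  a∈A = ⇒∈A vb<va
  b∉A : b ∉ A
  b∉A b∈A = ℤₚ.<-irrefl refl (∈A⇒ b∈A)

  v≈𝟙A+excess : v ≈N (λ i → 𝟙 A i + excess t (v i))
  v≈𝟙A+excess = t , λ i → trans (split (v i) t (above t (v i)))
    (cong (λ s → (s + excess t (v i)) + t) (sym (𝟙A≡above i)))
    where
    split : ∀ x t s → x ≡ (s + ((x - t) - s)) + t
    split = solve-∀
    𝟙A≡above : ∀ i → 𝟙 A i ≡ above t (v i)
    𝟙A≡above i = cong (λ β → if β then + 1 else 0ℤ) (Vecₚ.lookup∘tabulate (λ j → does (t ℤₚ.<? v j)) i)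

  ⟨u,𝟙A⟩≡0 : ⟨ u , 𝟙 A ⟩ ≡ 0ℤ
  ⟨u,𝟙A⟩≡0 = +-nonneg-≡0ˡ (u≥0 (𝟙 A) (𝟙∈BraidCone A-up))
                          (u≥0 (excess t ∘ v) (λ i j Rij → excess-mono t (v∈C i j Rij))) (begin
    ⟨ u , 𝟙 A ⟩ + ⟨ u , excess t ∘ v ⟩      ≡⟨ pairing-+ʳ u (𝟙 A) (excess t ∘ v) ⟨
    ⟨ u , (λ i → 𝟙 A i + excess t (v i)) ⟩ ≡⟨ pairing-≈N u u∈M v≈𝟙A+excess ⟨
    ⟨ u , v ⟩                              ≡⟨ ⟨u,v⟩≡0 ⟩
    0ℤ                                     ∎)

  fromFace : (∃ λ k → 𝟙 A ≈N (k ·N v)) → v ≈N 𝟙 A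
  fromFace (k , c , 𝟙A≡kv+c) = - c , λ i → begin
    v i                         ≡⟨ unshift (v i) c ⟩
    (+ 1 * v i + c) + - c       ≡⟨ cong (λ m → (+ m * v i + c) + - c) k≡1 ⟨
    (+ k * v i + c) + - c       ≡⟨ cong (λ s → s + - c) (𝟙A≡kv+c i) ⟨
    𝟙 A i + - c                 ∎
    where
    unshift : ∀ x c → x ≡ (+ 1 * x + c) + - c
    unshift = solve-∀
    difference : ∀ k x y c → k * (x - y) ≡ (k * x + c) - (k * y + c)
    difference = solve-∀
    k≡1 : k ≡ 1
    k≡1 = +k*x≡1⇒k≡1 k (v a - v b) (begin
      + k * (v a - v b)                       ≡⟨ difference (+ k) (v a) (v b) c ⟩
      (+ k * v a + c) - (+ k * v b + c)       ≡⟨ cong₂ _-_ (𝟙A≡kv+c a) (𝟙A≡kv+c b) ⟨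
      𝟙 A a - 𝟙 A b                           ≡⟨ cong₂ _-_ (if-∈ a∈A) (if-∉ b∉A) ⟩
      + 1                                     ∎)

LinearOrder : ∀ {n} → Permutation′ n → Rel (Fin n) 0ℓ
LinearOrder π i j = π ⟨$⟩ʳ i Fin.< π ⟨$⟩ʳ j

module _ {n} (π : Permutation′ n) where

  ≤⇒≡⊎LinearOrder : ∀ {i j} → π ⟨$⟩ʳ i Fin.≤ π ⟨$⟩ʳ j → i ≡ j ⊎ LinearOrder π i j
  ≤⇒≡⊎LinearOrder {i} {j} i≤j with ℕₚ.m≤n⇒m<n∨m≡n i≤j
  ... | inj₁ i<j = inj₂ i<j
  ... | inj₂ i≡j = inj₁ (begin
    i                       ≡⟨ inverseˡ π ⟨
    π ⟨$⟩ˡ (π ⟨$⟩ʳ i)       ≡⟨ cong (π ⟨$⟩ˡ_) (Finₚ.toℕ-injective i≡j) ⟩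
    π ⟨$⟩ˡ (π ⟨$⟩ʳ j)       ≡⟨ inverseˡ π ⟩
    j                       ∎)
    where open ≡-Reasoning

  BraidCone-≤ : ∀ {x} → BraidCone (LinearOrder π) x → ∀ {i j} → π ⟨$⟩ʳ i Fin.≤ π ⟨$⟩ʳ j → x i ℤ.≤ x j
  BraidCone-≤ x∈C {i} {j} i≤j with ≤⇒≡⊎LinearOrder i≤j
  ... | inj₁ refl = ℤₚ.≤-refl
  ... | inj₂ Lij  = x∈C i j Lij

  UpClosed-≤ : ∀ {A} → UpClosed (LinearOrder π) A → ∀ {i j} → i ∈ A → π ⟨$⟩ʳ i Fin.≤ π ⟨$⟩ʳ j → j ∈ A
  UpClosed-≤ A-up {i} {j} i∈A i≤j with ≤⇒≡⊎LinearOrder i≤j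
  ... | inj₁ refl = i∈A
  ... | inj₂ Lij  = A-up i j i∈A Lij

module _ {m} (π : Permutation′ (suc m)) where

  top bottom : Fin (suc m)
  top    = π ⟨$⟩ˡ Fin.fromℕ m
  bottom = π ⟨$⟩ˡ Fin.zero

  ≤top : ∀ i → π ⟨$⟩ʳ i Fin.≤ π ⟨$⟩ʳ top
  ≤top i = subst (π ⟨$⟩ʳ i Fin.≤_) (sym (inverseʳ π)) (Finₚ.≤fromℕ (π ⟨$⟩ʳ i))

  bottom≤ : ∀ i → π ⟨$⟩ʳ bottom Fin.≤ π ⟨$⟩ʳ i
  bottom≤ i = subst (Fin._≤ π ⟨$⟩ʳ i) (sym (inverseʳ π)) z≤n

upsetIndicator-rayGen : ∀ {n} (π : Permutation′ n) {A} →
  ProperUpClosed (LinearOrder π) A → IsRayGen (LinearOrder π) (𝟙 A)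
upsetIndicator-rayGen {suc m} π {A} (A-up , (a , a∈A) , (b′ , b′∉A)) =
  𝟙∈BraidCone A-up , 𝟙≉0 , u , u∈M , u≥0 , ⟨u,𝟙A⟩≡0 , face
  where
  open ≡-Reasoning
  t∈A : top π ∈ A
  t∈A = UpClosed-≤ π A-up a∈A (≤top π a)
  b∉A : bottom π ∉ A
  b∉A b∈A = b′∉A (UpClosed-≤ π A-up b∈A (bottom≤ π b′))

  𝟙≉0 : ¬ 𝟙 A ≈N (λ _ → 0ℤ)
  𝟙≉0 (c , 𝟙A≡c) with () ← trans (sym (if-∈ a∈A)) (trans (𝟙A≡c a) (trans (sym (𝟙A≡c b′)) (if-∉ b′∉A)))

  -- Every gap is nonnegative on the chamber, and all vanish exactly when x is constant on A and
  -- on its complement.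
  hi lo : Fin (suc m) → Fin (suc m)
  hi k = if lookup A k then top π else k
  lo k = if lookup A k then k else bottom π

  u : Vecℤ (suc m)
  u = differences hi lo

  gap : Vecℤ (suc m) → Fin (suc m) → ℤ
  gap x k = x (hi k) - x (lo k)

  gap-∈ : ∀ x {k} → k ∈ A → gap x k ≡ x (top π) - x k
  gap-∈ x k∈A = cong₂ _-_ (cong x (if-∈ k∈A)) (cong x (if-∈ k∈A))
  gap-∉ : ∀ x {k} → k ∉ A → gap x k ≡ x k - x (bottom π)
  gap-∉ x k∉A = cong₂ _-_ (cong x (if-∉ k∉A)) (cong x (if-∉ k∉A))

  u∈M : InM u
  u∈M = InM-from-pairing u (trans (⟨differences,x⟩ hi lo (λ _ → + 1)) (sumFin-zero (suc m)))

  gap≥0 : ∀ {x} → BraidCone (LinearOrder π) x → ∀ k → 0ℤ ℤ.≤ gap x k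
  gap≥0 {x} x∈C k with k Subsetₚ.∈? A
  ... | yes k∈A = subst (0ℤ ℤ.≤_) (sym (gap-∈ x k∈A)) (ℤₚ.i≤j⇒0≤j-i (BraidCone-≤ π x∈C (≤top π k)))
  ... | no k∉A  = subst (0ℤ ℤ.≤_) (sym (gap-∉ x k∉A)) (ℤₚ.i≤j⇒0≤j-i (BraidCone-≤ π x∈C (bottom≤ π k)))

  u≥0 : ∀ x → BraidCone (LinearOrder π) x → 0ℤ ℤ.≤ ⟨ u , x ⟩
  u≥0 x x∈C = subst (0ℤ ℤ.≤_) (sym (⟨differences,x⟩ hi lo x)) (sumFin-nonneg (suc m) (gap≥0 x∈C))

  ⟨u,𝟙A⟩≡0 : ⟨ u , 𝟙 A ⟩ ≡ 0ℤ
  ⟨u,𝟙A⟩≡0 = trans (⟨differences,x⟩ hi lo (𝟙 A)) (trans (sumFin-cong (suc m) gap≡0) (sumFin-zero (suc m)))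
    where
    gap≡0 : ∀ k → gap (𝟙 A) k ≡ 0ℤ
    gap≡0 k with k Subsetₚ.∈? A
    ... | yes k∈A = trans (gap-∈ (𝟙 A) k∈A) (cong₂ _-_ (if-∈ t∈A) (if-∈ k∈A))
    ... | no k∉A  = trans (gap-∉ (𝟙 A) k∉A) (cong₂ _-_ (if-∉ k∉A) (if-∉ b∉A))

  face : ∀ x → BraidCone (LinearOrder π) x → ⟨ u , x ⟩ ≡ 0ℤ → ∃ λ k → x ≈N (k ·N 𝟙 A)
  face x x∈C ⟨u,x⟩≡0 = ℤ.∣ height ∣ , x (bottom π) , x≡height·𝟙A+x₀
    where
    gap≡0 : ∀ k → gap x k ≡ 0ℤ
    gap≡0 = sumFin-nonneg-≡0 (suc m) (gap≥0 x∈C) (trans (sym (⟨differences,x⟩ hi lo x)) ⟨u,x⟩≡0)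
    height = x (top π) - x (bottom π)
    +∣height∣≡height : + ℤ.∣ height ∣ ≡ height
    +∣height∣≡height = ℤₚ.0≤i⇒+∣i∣≡i (ℤₚ.i≤j⇒0≤j-i (BraidCone-≤ π x∈C (bottom≤ π (top π))))
    x≡height·𝟙A+x₀ : ∀ k → x k ≡ + ℤ.∣ height ∣ * 𝟙 A k + x (bottom π)
    x≡height·𝟙A+x₀ k with k Subsetₚ.∈? A
    ... | yes k∈A = begin
      x k                                     ≡⟨ ℤₚ.i-j≡0⇒i≡j _ _ (trans (sym (gap-∈ x k∈A)) (gap≡0 k)) ⟨
      x (top π)                               ≡⟨ restore (x (top π)) (x (bottom π)) ⟩
      height * + 1 + x (bottom π)             ≡⟨ cong₂ (λ h s → h * s + x (bottom π)) +∣height∣≡height (if-∈ k∈A) ⟨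
      + ℤ.∣ height ∣ * 𝟙 A k + x (bottom π)   ∎
      where
      restore : ∀ y z → y ≡ (y - z) * + 1 + z
      restore = solve-∀
    ... | no k∉A = begin
      x k                                     ≡⟨ ℤₚ.i-j≡0⇒i≡j _ _ (trans (sym (gap-∉ x k∉A)) (gap≡0 k)) ⟩
      x (bottom π)                            ≡⟨ ℤₚ.+-identityˡ (x (bottom π)) ⟨
      0ℤ + x (bottom π)                       ≡⟨ cong (λ s → s + x (bottom π)) (ℤₚ.*-zeroʳ (+ ℤ.∣ height ∣)) ⟨
      + ℤ.∣ height ∣ * 0ℤ + x (bottom π)      ≡⟨ cong (λ s → + ℤ.∣ height ∣ * s + x (bottom π)) (if-∉ k∉A) ⟨
      + ℤ.∣ height ∣ * 𝟙 A k + x (bottom π)   ∎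

injective⇒surjective : ∀ {n} (f : Fin n → Fin n) → Injective _≡_ _≡_ f → ∀ y → ∃ λ x → f x ≡ y
injective⇒surjective {suc n} f f-inj y with Finₚ.any? (λ x → f x Finₚ.≟ y)
... | yes hit  = hit
... | no  miss = ⊥-elim (ℕₚ.<-irrefl refl (Finₚ.injective⇒≤ squeeze-injective))
  where
  y≢f : ∀ x → y ≢ f x
  y≢f x y≡fx = miss (x , sym y≡fx)
  squeeze : Fin (suc n) → Fin n
  squeeze x = Fin.punchOut (y≢f x)
  squeeze-injective : Injective _≡_ _≡_ squeeze
  squeeze-injective {x} {x′} eq = f-inj (Finₚ.punchOut-injective (y≢f x) (y≢f x′) eq)

injective⇒permutation : ∀ {n} (f : Fin n → Fin n) → Injective _≡_ _≡_ f →
  Σ (Permutation′ n) λ π → ∀ i → π ⟨$⟩ʳ i ≡ f i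
injective⇒permutation f f-inj =
  permutation f (proj₁ ∘ surj) (proj₂ ∘ surj) (λ x → f-inj (proj₂ (surj (f x)))) , λ _ → refl
  where
  surj = injective⇒surjective f f-inj

below : ∀ {n} {_≺_ : Rel (Fin n) 0ℓ} → Decidable _≺_ → Fin n → Subset n
below _≺?_ j = toSubset (λ i → i ≺? j)

module _ {n} {_≺_ : Rel (Fin n) 0ℓ} (_≺?_ : Decidable _≺_) (≺-irrefl : Irreflexive _≡_ _≺_) where

  private
    ∈below⇒ : ∀ {i j} → i ∈ below _≺?_ j → i ≺ j
    ∈below⇒ = Equivalence.to (∈-toSubset (λ i → i ≺? _))
    ⇒∈below : ∀ {i j} → i ≺ j → i ∈ below _≺?_ j
    ⇒∈below = Equivalence.from (∈-toSubset (λ i → i ≺? _))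

  ∣below∣-strictMono : Transitive _≺_ → ∀ {i j} → i ≺ j → ∣ below _≺?_ i ∣ < ∣ below _≺?_ j ∣
  ∣below∣-strictMono ≺-trans {i} i≺j = Subsetₚ.p⊂q⇒∣p∣<∣q∣
    ( (λ k∈ → ⇒∈below (≺-trans (∈below⇒ k∈) i≺j))
    , i , ⇒∈below i≺j , λ i∈ → ≺-irrefl refl (∈below⇒ i∈))

  ∣below∣<n : ∀ i → ∣ below _≺?_ i ∣ < n
  ∣below∣<n i = subst (∣ below _≺?_ i ∣ <_) (Subsetₚ.∣⊤∣≡n n) (Subsetₚ.p⊂q⇒∣p∣<∣q∣
    ((λ _ → Subsetₚ.∈⊤) , i , Subsetₚ.∈⊤ , λ i∈ → ≺-irrefl refl (∈below⇒ i∈)))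

rankPermutation : ∀ {n} (key : Fin n → ℕ) → Injective _≡_ _≡_ key →
  Σ (Permutation′ n) λ π → ∀ {i j} → key i < key j → LinearOrder π i j
rankPermutation {n} key key-inj = π , λ {i} {j} lt →
  subst₂ Fin._<_ (sym (π≗rank i)) (sym (π≗rank j)) (rank-mono lt)
  where
  _≺?_ : Decidable (λ i j → key i < key j)
  i ≺? j = key i ℕₚ.<? key j
  ≺-irrefl : Irreflexive _≡_ (λ i j → key i < key j)
  ≺-irrefl refl = ℕₚ.<-irrefl refl
  rank : Fin n → Fin n
  rank i = Fin.fromℕ< (∣below∣<n _≺?_ ≺-irrefl i)
  rank-mono : ∀ {i j} → key i < key j → rank i Fin.< rank j
  rank-mono lt = subst₂ _<_ (sym (Finₚ.toℕ-fromℕ< _)) (sym (Finₚ.toℕ-fromℕ< _))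
    (∣below∣-strictMono _≺?_ ≺-irrefl ℕₚ.<-trans lt)
  rank-injective : Injective _≡_ _≡_ rank
  rank-injective {i} {j} eq with ℕₚ.<-cmp (key i) (key j)
  ... | tri< lt _ _ = ⊥-elim (Finₚ.<-irrefl eq (rank-mono lt))
  ... | tri≈ _ e _  = key-inj e
  ... | tri> _ _ gt = ⊥-elim (Finₚ.<-irrefl (sym eq) (rank-mono gt))
  π = proj₁ (injective⇒permutation rank rank-injective)
  π≗rank = proj₂ (injective⇒permutation rank rank-injective)

weight⇒linearExtension : ∀ {n} (P : FinPoset n) (w : Fin n → ℕ) → (∀ {i j} → _<P_ P i j → w i < w j) →
  Σ (LinearExtension P) λ L → ∀ {i j} → w i < w j → σL {P = P} L i j
weight⇒linearExtension {n} P w w-mono = (π , λ i j i<j → π-mono (key-< (w-mono i<j))) , π-mono ∘ key-<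
  where
  -- w with ties broken by the index, hence injective.
  key : Fin n → ℕ
  key i = w i ℕ.* n ℕ.+ toℕ i
  key-< : ∀ {i j} → w i < w j → key i < key j
  key-< {i} {j} wi<wj = begin-strict
    w i ℕ.* n ℕ.+ toℕ i   <⟨ ℕₚ.+-monoʳ-< (w i ℕ.* n) (Finₚ.toℕ<n i) ⟩
    w i ℕ.* n ℕ.+ n       ≡⟨ ℕₚ.+-comm (w i ℕ.* n) n ⟩
    suc (w i) ℕ.* n       ≤⟨ ℕₚ.*-monoˡ-≤ n wi<wj ⟩
    w j ℕ.* n             ≤⟨ ℕₚ.m≤m+n (w j ℕ.* n) (toℕ j) ⟩
    key j                 ∎
    where open ℕₚ.≤-Reasoning
  key-injective : Injective _≡_ _≡_ key
  key-injective {i} {j} eq with ℕₚ.<-cmp (w i) (w j)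
  ... | tri< lt _ _ = ⊥-elim (ℕₚ.<-irrefl eq (key-< lt))
  ... | tri> _ _ gt = ⊥-elim (ℕₚ.<-irrefl (sym eq) (key-< gt))
  ... | tri≈ _ e _  = Finₚ.toℕ-injective
    (ℕₚ.+-cancelˡ-≡ (w i ℕ.* n) (toℕ i) (toℕ j) (trans eq (cong (λ k → k ℕ.* n ℕ.+ toℕ j) (sym e))))
  π = proj₁ (rankPermutation key key-injective)
  π-mono = proj₂ (rankPermutation key key-injective)

upset⇒linearExtension : ∀ {n} (P : FinPoset n) {A} → IsUpset P A →
  Σ (LinearExtension P) λ L → UpClosed (σL {P = P} L) A
upset⇒linearExtension {n} P {A} A-up = L , L-up
  where
  open IsStrictPartialOrder (isSPO P) using (irrefl) renaming (trans to <P-trans)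
  depth bonus w : Fin n → ℕ
  depth i = ∣ below (_<P?_ P) i ∣
  -- The bonus n exceeds every depth, so w ranks all of A after its complement.
  bonus i = if lookup A i then n else 0
  w i = depth i ℕ.+ bonus i

  bonus-mono : ∀ {i j} → _<P_ P i j → bonus i ≤ bonus j
  bonus-mono {i} {j} i<j with i Subsetₚ.∈? A
  ... | yes i∈A = ℕₚ.≤-reflexive (trans (if-∈ i∈A) (sym (if-∈ (A-up i j i∈A i<j))))
  ... | no  i∉A = subst (_≤ bonus j) (sym (if-∉ i∉A)) z≤n

  w-mono : ∀ {i j} → _<P_ P i j → w i < w j
  w-mono i<j = ℕₚ.+-mono-<-≤ (∣below∣-strictMono (_<P?_ P) irrefl <P-trans i<j) (bonus-mono i<j)

  A-last : ∀ {i j} → i ∉ A → j ∈ A → w i < w j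
  A-last {i} {j} i∉A j∈A = begin-strict
    depth i ℕ.+ bonus i  ≡⟨ cong (depth i ℕ.+_) (if-∉ i∉A) ⟩
    depth i ℕ.+ 0        ≡⟨ ℕₚ.+-identityʳ (depth i) ⟩
    depth i              <⟨ ∣below∣<n (_<P?_ P) irrefl i ⟩
    n                    ≤⟨ ℕₚ.m≤n+m n (depth j) ⟩
    depth j ℕ.+ n        ≡⟨ cong (depth j ℕ.+_) (if-∈ j∈A) ⟨
    depth j ℕ.+ bonus j  ∎
    where open ℕₚ.≤-Reasoning

  L = proj₁ (weight⇒linearExtension P w w-mono)
  L-respects-w = proj₂ (weight⇒linearExtension P w w-mono)

  L-up : UpClosed (σL {P = P} L) A
  L-up i j i∈A Lij with j Subsetₚ.∈? A
  ... | yes j∈A = j∈A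
  ... | no  j∉A = ⊥-elim (ℕₚ.<-asym Lij (L-respects-w (A-last j∉A i∈A)))

module _ {n} (P : FinPoset n) where

  Reach-mono : ∀ {S S′} → (∀ {k} → k ∈ S → k ∈ S′) → ∀ {i j} → Reach P S i j → Reach P S′ i j
  Reach-mono S⊆S′ (here i∈S)         = here (S⊆S′ i∈S)
  Reach-mono S⊆S′ (step i∈S i~j j⇝k) = step (S⊆S′ i∈S) i~j (Reach-mono S⊆S′ j⇝k)

  HasCC-empty : ∀ {S} → (∀ i → i ∉ S) → HasCC P S 0
  HasCC-empty S-empty = (λ i i∈S → ⊥-elim (S-empty i i∈S)) , (λ i _ i∈S _ → ⊥-elim (S-empty i i∈S)) , λ ()

  HasCC-full : HasseConnected P → Fin n → ∀ {S} → (∀ i → i ∈ S) → HasCC P S 1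
  HasCC-full conn x₀ S-full =
    (λ _ _ → Fin.zero) ,
    (λ i j _ _ → mk⇔ (λ _ → refl) (λ _ → Reach-mono (λ _ → S-full _) (conn i j))) ,
    λ { Fin.zero → x₀ , S-full x₀ , refl }

  properUpset⇒DimPositive : ∀ {A a b} → a ∈ A → b ∉ A → DimPositive P A
  properUpset⇒DimPositive a∈A b∉A _ _ (cA , _) (c∁A , _) =
    ℕₚ.+-mono-≤ (inhabited (cA _ a∈A)) (inhabited (c∁A _ (Subsetₚ.x∉p⇒x∈∁p b∉A)))
    where
    inhabited : ∀ {k} → Fin k → 1 ≤ k
    inhabited Fin.zero    = s≤s z≤n
    inhabited (Fin.suc _) = s≤s z≤n

  module _ (conn : HasseConnected P) (x₀ : Fin n) {A : Subset n} (A-dim : DimPositive P A) where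

    DimPositive⇒nonempty : ∃ λ a → a ∈ A
    DimPositive⇒nonempty with Finₚ.any? (Subsetₚ._∈? A)
    ... | yes hit  = hit
    ... | no  miss = ⊥-elim (ℕₚ.<-irrefl refl (A-dim 0 1 (HasCC-empty (λ i i∈A → miss (i , i∈A)))
                       (HasCC-full conn x₀ (λ i → Subsetₚ.x∉p⇒x∈∁p (λ i∈A → miss (i , i∈A))))))

    DimPositive⇒proper : ∃ λ b → b ∉ A
    DimPositive⇒proper with Finₚ.any? (Subsetₚ._∈? ∁ A)
    ... | yes (b , b∈∁A) = b , Subsetₚ.x∈∁p⇒x∉p b∈∁A
    ... | no  miss       = ⊥-elim (ℕₚ.<-irrefl refl (A-dim 1 0
                             (HasCC-full conn x₀ (λ i → Subsetₚ.x∉∁p⇒x∈p (λ i∈∁A → miss (i , i∈∁A))))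
                             (HasCC-empty (λ i i∈∁A → miss (i , i∈∁A)))))

module _ {n} {P : FinPoset n} {r : ℕ} where

  labeling-upsetIndicator : (φ : ChamberCrepantLabeling P r) {A : Subset n} → ProperUpClosed (_<P_ P) A →
    ∀ {v} → v ≈N 𝟙 A → ⟨ proj₁ φ , v ⟩ ≡ + r
  labeling-upsetIndicator (φ , φ∈M , φ-upsets) {A} (A-up , (a , a∈A) , (b , b∉A)) {v} v≈𝟙A = begin
    ⟨ φ , v ⟩     ≡⟨ pairing-≈N φ φ∈M v≈𝟙A ⟩
    ⟨ φ , 𝟙 A ⟩   ≡⟨ pairing-𝟙 φ A ⟩
    sumOver A φ   ≡⟨ φ-upsets A A-up (properUpset⇒DimPositive P a∈A b∉A) ⟩
    + r           ∎
    where open ≡-Reasoning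

  labeling-rayGen : (φ : ChamberCrepantLabeling P r) {R : Rel (Fin n) 0ℓ} → (∀ i j → _<P_ P i j → R i j) →
    ∀ {v} → IsRayGen R v → ⟨ proj₁ φ , v ⟩ ≡ + r
  labeling-rayGen φ {R} P⊆R v-ray =
    let A , (A-up , A-nonempty , A-proper) , v≈𝟙A = rayGen⇒upsetIndicator R v-ray
    in  labeling-upsetIndicator φ ((λ i j i∈A i<j → A-up i j i∈A (P⊆R i j i<j)) , A-nonempty , A-proper) v≈𝟙A

  labeling⇒crepant : ChamberCrepantLabeling P r → IsCrepant P r
  labeling⇒crepant φ@(u , u∈M , _) =
    u , (u∈M , λ v → labeling-rayGen φ (λ _ _ i<j → i<j)) ,
    λ { v (L , v-ray) → labeling-rayGen φ (proj₂ L) v-ray }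

  crepant⇒labeling : HasseConnected P → Fin n → IsCrepant P r → ChamberCrepantLabeling P r
  crepant⇒labeling conn x₀ (u , (u∈M , _) , u-fan) = u , u∈M , u-upsets
    where
    u-upsets : ∀ A → IsUpset P A → DimPositive P A → sumOver A u ≡ + r
    u-upsets A A-up A-dim =
      let L , A-upL = upset⇒linearExtension P A-up
          A-ray = upsetIndicator-rayGen (proj₁ L)
                    (A-upL , DimPositive⇒nonempty P conn x₀ A-dim , DimPositive⇒proper P conn x₀ A-dim)
      in  trans (sym (pairing-𝟙 u A)) (u-fan (𝟙 A) (L , A-ray))

proposition2p7 : ∀ (n : ℕ) (P : FinPoset n) → 2 ≤ n → HasseConnected P →
    ∀ (r : ℕ) → IsGorensteinIndex P r →
    (ChamberCrepantLabeling P r ⇔ IsCrepant P r)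
-- The equivalence holds for every r, so the Gorenstein index hypothesis is not needed.
proposition2p7 (suc _) P _ conn r _ = mk⇔ labeling⇒crepant (crepant⇒labeling conn Fin.zero)
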